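{- For all integers $n,w,s\ge 1$ with $2^n\ge s\ge 6nw$ and every unsatisfiable CNF $F$ with $n$ variables, every Resolution refutation of $\mathrm{REF}(F,s)$ has index-width at least $w$.
   Context: Resolution: a clause is a set of literals (variables $X$ or negations $\bar X$), non-tautological if it does not contain both $X$ and $\bar X$; a CNF is a set of clauses. $D$ is a weakening of $C$ if $C\subseteq D$; if $X\in C$, $\bar X\in D$, the resolvent on $X$ is $(C\setminus\{X\})\cup(D\setminus\{\bar X\})$. A Resolution refutation of a CNF $G$ is a sequence $(D_1,\dots,D_\ell)$ of non-tautological clauses with $D_\ell=\emptyset$, each $D_u$ a weakening of a clause of $G$ or of a resolvent of some $D_v,D_w$ with $v,w<u$. Definition of $\mathrm{REF}(F,s)$: let $F$ be a CNF with variables $X_1,\dots,X_n$ and non-tautological clauses $C_1,\dots,C_m$; write $X^{(1)}=X$, $X^{(0)}=\bar X$, $\mathrm{B}=\{0,1\}$, $[k]=\{1,\dots,k\}$. The variables of $\mathrm{REF}(F,s)$ are $D[u,i,b]$ ($u\in[s],i\in[n],b\in\mathrm{B}$), $V[u,i]$ ($u\in[s],i\in[n]\cup\{0\}$), $I[u,j]$ ($u\in[s],j\in[m]\cup\{0\}$), $L[u,v]$ and $R[u,v]$ ($u\in[s],v\in[s]\cup\{0\}$). Its clauses are, for all $u,v\in[s]$ etc. as indicated: (A1) $V[u,0]\vee\dots\vee V[u,n]$; (A2) $I[u,0]\vee\dots\vee I[u,m]$; (A3) $L[u,0]\vee\dots\vee L[u,s]$; (A4) $R[u,0]\vee\dots\vee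 R[u,s]$; (A5) $\bar V[u,i]\vee\bar V[u,i']$ for $i\ne i'\in[n]\cup\{0\}$; (A6) $\bar I[u,j]\vee\bar I[u,j']$ for $j\ne j'\in[m]\cup\{0\}$; (A7) $\bar L[u,v]\vee\bar L[u,v']$ and (A8) $\bar R[u,v]\vee\bar R[u,v']$ for $v\ne v'\in[s]\cup\{0\}$; (A9) $\bar I[u,0]\vee\bar V[u,0]$; (A10) $I[u,0]\vee V[u,0]$; (A11) $\bar I[u,0]\vee\bar L[u,0]$; (A12) $\bar I[u,0]\vee\bar R[u,0]$; (A13) $\bar L[u,v]$ and (A14) $\bar R[u,v]$ for $u,v\in[s]$ with $u\le v$; (A15) $\bar L[u,v]\vee\bar V[u,i]\vee D[v,i,0]$ and (A16) $\bar R[u,v]\vee\bar V[u,i]\vee D[v,i,1]$ for $i\in[n]$; (A17) $\bar L[u,v]\vee\bar V[u,i]\vee\bar D[v,i',b]\vee D[u,i',b]$ and (A18) $\bar R[u,v]\vee\bar V[u,i]\vee\bar D[v,i',b]\vee D[u,i',b]$ for $i\ne i'\in[n]$, $b\in\mathrm{B}$; (A19) $\bar I[u,j]\vee D[u,i,b]$ for $j\in[m]$ and $X_i^{(b)}\in C_j$; (A20) $\bar D[u,i,0]\vee\bar D[u,i,1]$ for $i\in[n]$; (A21) $\bar D[s,i,b]$ for $i\in[n]$, $b\in\mathrm{B}$. (This CNF is satisfiable iff $F$ has a Resolution refutation of length $s$.) Index-width: an index $u\in[s]$ is mentioned in the variables $D[u,i,b],V[u,i],I[u,j],L[u,v],R[u,v]$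 (only the first index is mentioned; $v\ne u$ is not mentioned in $L[u,v]$ or $R[u,v]$). The index-width of a clause is the number of indices in $[s]$ mentioned by some variable occurring in it; the index-width of a refutation is the maximum index-width of its clauses. -}

module Defs where

open import Data.Nat using (ℕ; zero; suc; _≤_; _⊔_)
open import Data.Bool using (Bool; true; false)
open import Data.Fin using (Fin; toℕ; fromℕ; _≟_) renaming (_<_ to _<ᶠ_; zero to fz; suc to fs)
open import Data.List using (List; []; _∷_; map; allFin; filter; length; foldr)
open import Data.List.Membership.Propositional using (_∈_)
open import Data.List.Relation.Binary.Subset.Propositional using (_⊆_)
open import Data.List.Relation.Unary.Any using (Any; any?)
open import Data.Product using (Σ; _×_)
open import Data.Sum using (_⊎_)
open import Relation.Binary.PropositionalEquality using (_≡_; _≢_)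
open import Relation.Nullary using (¬_)

-- lit x b is X^(b):  lit x true = X,  lit x false = X̄
data Lit (V : Set) : Set where
  lit : V → Bool → Lit V

var : ∀ {V} → Lit V → V
var (lit x _) = x

pos neg : ∀ {V} → V → Lit V
pos x = lit x true
neg x = lit x false

-- a clause is a (finite) set of literals, represented by a list up to membership
Clause : Set → Set
Clause V = List (Lit V)

CNF : Set → Set₁
CNF V = Clause V → Set

NonTaut : ∀ {V} → Clause V → Set
NonTaut C = ∀ x → ¬ (pos x ∈ C × neg x ∈ C)

SatLit : ∀ {V} → (V → Bool) → Lit V → Set
SatLit α (lit x b) = α x ≡ b

SatClause : ∀ {V} → (V → Bool) → Clause V → Set
SatClause α C = Any (SatLit α) C

-- F with n variables X_1..X_n (as Fin n) and m clauses C_1..C_m (as Fin m)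
Unsat : ∀ {n m} → (Fin m → Clause (Fin n)) → Set
Unsat {n} F = ¬ (Σ (Fin n → Bool) λ α → ∀ j → SatClause α (F j))

WeakResolvent : ∀ {V} → Clause V → Clause V → V → Clause V → Set
WeakResolvent C E x D =
  pos x ∈ C × neg x ∈ E ×
  (∀ l → l ∈ C → l ≢ pos x → l ∈ D) ×
  (∀ l → l ∈ E → l ≢ neg x → l ∈ D)

Step : ∀ {V} (G : CNF V) {ℓ} (cl : Fin ℓ → Clause V) → Fin ℓ → Set
Step {V} G {ℓ} cl u =
  (Σ (Clause V) λ C → G C × C ⊆ cl u) ⊎
  (Σ (Fin ℓ) λ v → Σ (Fin ℓ) λ w → v <ᶠ u × w <ᶠ u ×
     Σ V λ x → WeakResolvent (cl v) (cl w) x (cl u))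

-- a refutation (D_1,…,D_{len+1}) of length len+1 ≥ 1
record Refutation {V : Set} (G : CNF V) : Set where
  field
    len     : ℕ
    cl      : Fin (suc len) → Clause V
    nontaut : ∀ u → NonTaut (cl u)
    empty   : cl (fromℕ len) ≡ []
    step    : ∀ u → Step G cl u

-- The formula REF(F,s)
-- Indices u ∈ [s] are Fin s (u ↦ toℕ u + 1); elements of [k] ∪ {0} are
-- Fin (suc k) with fz = 0 and fs i = i+1; elements of [n] are Fin n.

data RVar (n m s : ℕ) : Set where
  D : Fin s → Fin n → Bool → RVar n m s
  V : Fin s → Fin (suc n) → RVar n m s
  I : Fin s → Fin (suc m) → RVar n m s
  L : Fin s → Fin (suc s) → RVar n m s
  R : Fin s → Fin (suc s) → RVar n m s

data REF (n m s : ℕ) (F : Fin m → Clause (Fin n)) : CNF (RVar n m s) where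
  A1  : ∀ u → REF n m s F (map (λ i → pos (V u i)) (allFin (suc n)))
  A2  : ∀ u → REF n m s F (map (λ j → pos (I u j)) (allFin (suc m)))
  A3  : ∀ u → REF n m s F (map (λ v → pos (L u v)) (allFin (suc s)))
  A4  : ∀ u → REF n m s F (map (λ v → pos (R u v)) (allFin (suc s)))
  A5  : ∀ u i i' → i ≢ i' → REF n m s F (neg (V u i) ∷ neg (V u i') ∷ [])
  A6  : ∀ u j j' → j ≢ j' → REF n m s F (neg (I u j) ∷ neg (I u j') ∷ [])
  A7  : ∀ u v v' → v ≢ v' → REF n m s F (neg (L u v) ∷ neg (L u v') ∷ [])
  A8  : ∀ u v v' → v ≢ v' → REF n m s F (neg (R u v) ∷ neg (R u v') ∷ [])
  A9  : ∀ u → REF n m s F (neg (I u fz) ∷ neg (V u fz) ∷ [])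
  A10 : ∀ u → REF n m s F (pos (I u fz) ∷ pos (V u fz) ∷ [])
  A11 : ∀ u → REF n m s F (neg (I u fz) ∷ neg (L u fz) ∷ [])
  A12 : ∀ u → REF n m s F (neg (I u fz) ∷ neg (R u fz) ∷ [])
  A13 : ∀ (u v : Fin s) → toℕ u ≤ toℕ v → REF n m s F (neg (L u (fs v)) ∷ [])
  A14 : ∀ (u v : Fin s) → toℕ u ≤ toℕ v → REF n m s F (neg (R u (fs v)) ∷ [])
  A15 : ∀ u v (i : Fin n) →
        REF n m s F (neg (L u (fs v)) ∷ neg (V u (fs i)) ∷ pos (D v i false) ∷ [])
  A16 : ∀ u v (i : Fin n) →
        REF n m s F (neg (R u (fs v)) ∷ neg (V u (fs i)) ∷ pos (D v i true) ∷ [])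
  A17 : ∀ u v (i i' : Fin n) → i ≢ i' → ∀ b →
        REF n m s F (neg (L u (fs v)) ∷ neg (V u (fs i)) ∷ neg (D v i' b) ∷ pos (D u i' b) ∷ [])
  A18 : ∀ u v (i i' : Fin n) → i ≢ i' → ∀ b →
        REF n m s F (neg (R u (fs v)) ∷ neg (V u (fs i)) ∷ neg (D v i' b) ∷ pos (D u i' b) ∷ [])
  A19 : ∀ u (j : Fin m) (i : Fin n) b → lit i b ∈ F j →
        REF n m s F (neg (I u (fs j)) ∷ pos (D u i b) ∷ [])
  A20 : ∀ u (i : Fin n) → REF n m s F (neg (D u i false) ∷ neg (D u i true) ∷ [])
  A21 : ∀ (u : Fin s) → suc (toℕ u) ≡ s → ∀ (i : Fin n) b → REF n m s F (neg (D u i b) ∷ [])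

-- the (first) index mentioned by a variable
index : ∀ {n m s} → RVar n m s → Fin s
index (D u _ _) = u
index (V u _) = u
index (I u _) = u
index (L u _) = u
index (R u _) = u

indexWidth : ∀ {n m s} → Clause (RVar n m s) → ℕ
indexWidth {s = s} C =
  length (filter (λ u → any? (λ l → index (var l) ≟ u) C) (allFin s))

refIndexWidth : ∀ {n m s} {G : CNF (RVar n m s)} → Refutation G → ℕ
refIndexWidth π = foldr _⊔_ 0 (map (λ u → indexWidth (cl u)) (allFin (suc len)))
  where open Refutation π

-- The argument is a Delayer strategy in the style of Atserias–Dalmau.
-- Module IndexWidthGame shows, for any CNF G whose variables carry an index
-- in Fin s, that a Strategy for fewer than w pebbled indices (good
-- assignments closed under restriction, extensible by one index, never
-- falsifying an axiom) rules out refutations of index-width < w: walking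
-- back from the empty clause we keep a good assignment falsifying the current
-- clause, and at a resolution step extend it to the index of the resolved
-- variable, which decides the falsified premise.
--
-- Module DecisionTreeStrategy builds such a strategy for REF(F,s) when
-- n·3w < s: the Delayer pretends the refutation is the decision tree of F
-- querying X_0,…,X_{n-1} in order.  Pebbled indices hold tree nodes, the last
-- index holds the root, and the children of a node are placed at fresh
-- earlier indices (FreshNumbers).  Nodes of depth d sit at indices
-- ≥ (n ∸ d)·3w, so every level has a window of 3w indices, more than the
-- ≤ 3(w-1) indices taken by the pebbles and their premises.
module Submission where

open import Defs
open import Data.Bool using (Bool; true; false; not)
open import Data.Bool.Properties using (not-involutive; ¬-not) renaming (_≟_ to _≟ᵇ_)
open import Data.Empty using (⊥; ⊥-elim)
open import Data.Fin using (Fin; toℕ; fromℕ; fromℕ<; _≟_) renaming (zero to fz; suc to fs; _<_ to _<ᶠ_)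
open import Data.Fin.Induction using (<-wellFounded)
open import Data.Fin.Properties using (toℕ-injective; toℕ-fromℕ<; toℕ<n; ¬∀⟶∃¬)
open import Data.List using (List; []; _∷_; _++_; length; map; filter; allFin)
open import Data.List.Properties using (length-++; length-map; filter-notAll; foldr-forcesᵇ)
open import Data.List.Membership.Propositional using (_∈_; _∉_; find; lose)
open import Data.List.Membership.Propositional.Properties
  using (∈-filter⁺; ∈-filter⁻; ∈-map⁺; ∈-allFin; ∈-++⁺ˡ; ∈-++⁺ʳ)
open import Data.List.Relation.Binary.Subset.Propositional using (_⊆_)
open import Data.List.Relation.Unary.Any using (here; there; any?)
open import Data.List.Relation.Unary.Any.Properties using (¬Any[])
import Data.List.Relation.Unary.All as AllList
open import Data.List.Relation.Unary.All.Properties using (map⁻)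
open import Data.Nat using (ℕ; zero; suc; _+_; _*_; _∸_; _^_; _≤_; _<_; _⊔_; _<?_; _≤?_; s≤s; z≤n; z<s)
  renaming (_≟_ to _≟ℕ_)
open import Data.Nat.Properties
  using (≤-refl; ≤-reflexive; ≤-trans; ≤-pred; <-trans; <-irrefl; <-≤-trans; ≤-<-trans; <⇒≢; <⇒≱; ≤∧≢⇒<;
         ≮⇒≥; ≰⇒>; n≮0; n<1+n; n≤1+n; m≤m+n; m<m+n; +-suc; +-comm; +-∸-assoc; *-suc; +-mono-≤;
         *-mono-≤; *-monoʳ-≤; m⊔n<o⇒m<o; m⊔n<o⇒n<o; module ≤-Reasoning)
open import Data.Nat.Tactic.RingSolver using (solve-∀)
open import Data.Product using (∃; _×_; _,_; proj₁; proj₂)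
open import Data.Sum using (_⊎_; inj₁; inj₂)
open import Data.Vec.Functional using (updateAt)
open import Data.Vec.Functional.Properties using (updateAt-updates; updateAt-minimal)
open import Function using (case_of_; const)
open import Induction.WellFounded using (module All)
open import Relation.Binary.PropositionalEquality using (_≡_; _≢_; refl; sym; trans; cong; subst)
open import Relation.Nullary using (¬_; ¬?; Dec; yes; no; does)
open import Relation.Nullary.Decidable using (_×-dec_)

module FreshNumbers where

  differs : ∀ lo x → Dec (¬ x ≡ lo)
  differs lo x = ¬? (x ≟ℕ lo)

  discardShortens : ∀ {lo} {O : List ℕ} → lo ∈ O → length (filter (differs lo) O) < length O
  discardShortens {lo} {O} lo∈O = filter-notAll (differs lo) O (lose lo∈O λ lo≢lo → lo≢lo refl)

  fresh : ∀ k (O : List ℕ) lo → length O < k → ∃ λ v → lo ≤ v × v < lo + k × v ∉ O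
  fresh zero O lo ()
  -- If lo is taken, discard its copies (a strictly shorter list remains)
  -- and search the window [lo + 1, lo + 1 + k).
  fresh (suc k) O lo |O|<1+k with any? (lo ≟ℕ_) O
  ... | no lo∉O = lo , ≤-refl , m<m+n lo z<s , lo∉O
  ... | yes lo∈O
    with v , 1+lo≤v , v<hi , v∉O′ ← fresh k (filter (differs lo) O) (suc lo)
                                         (<-≤-trans (discardShortens lo∈O) (≤-pred |O|<1+k)) =
    v , ≤-trans (n≤1+n lo) 1+lo≤v , subst (v <_) (sym (+-suc lo k)) v<hi ,
    λ v∈O → v∉O′ (∈-filter⁺ (differs lo) v∈O λ v≡lo → <⇒≢ 1+lo≤v (sym v≡lo))

module IndexWidthGame {V : Set} {s : ℕ} (ι : V → Fin s) (G : CNF V) where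

  -- The indices mentioned by the variables of a clause; for ι = index its
  -- length is exactly indexWidth.
  indices : Clause V → List (Fin s)
  indices C = filter (λ u → any? (λ l → ι (var l) ≟ u) C) (allFin s)

  indices⁺ : ∀ {C l} → l ∈ C → ι (var l) ∈ indices C
  indices⁺ {C} l∈C = ∈-filter⁺ (λ u → any? (λ l → ι (var l) ≟ u) C) (∈-allFin _) (lose l∈C refl)

  indices⁻ : ∀ {C u} → u ∈ indices C → ∃ λ l → l ∈ C × ι (var l) ≡ u
  indices⁻ {C} u∈ with _ , mentioned ← ∈-filter⁻ (λ u → any? (λ l → ι (var l) ≟ u) C) {xs = allFin s} u∈ =
    find mentioned

  Falsifies : (V → Bool) → Clause V → Set
  Falsifies α C = ∀ {l} → l ∈ C → ¬ SatLit α l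

  AgreeOn : List (Fin s) → (V → Bool) → (V → Bool) → Set
  AgreeOn S α β = ∀ y → ι y ∈ S → α y ≡ β y

  -- A strategy for the Delayer in the index-pebble game with fewer than w
  -- pebbles: a family of "good" assignments, indexed by the set of pebbled
  -- indices, that is closed under removing pebbles, never falsifies an
  -- axiom whose indices are all pebbled, and survives adding a pebble.
  record Strategy (w : ℕ) : Set₁ where
    field
      Good     : List (Fin s) → (V → Bool) → Set
      start    : ∃ (Good [])
      restrict : ∀ {S S′ α} → S′ ⊆ S → Good S α → Good S′ α
      sound    : ∀ {C α} → G C → Good (indices C) α → ¬ Falsifies α C
      extend   : ∀ {S α} → length S < w → Good S α → (t : Fin s) →
                 ∃ λ α′ → Good (t ∷ S) α′ × AgreeOn S α′ α

  module _ {E D : Clause V} {lx : Lit V} (fromE : ∀ l → l ∈ E → l ≢ lx → l ∈ D) where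

    premiseIndices : indices E ⊆ ι (var lx) ∷ indices D
    premiseIndices {u} u∈ with u ≟ ι (var lx) | indices⁻ u∈
    ... | yes refl | _ = here refl
    ... | no u≢ | l , l∈E , refl = there (indices⁺ (fromE l l∈E λ { refl → u≢ refl }))

    premiseFalsified : ∀ {α} → Falsifies α D → ¬ SatLit α lx → Falsifies α E
    premiseFalsified falsifiedD ¬lx {l} l∈E sat =
      falsifiedD (fromE l l∈E λ { refl → ¬lx sat }) sat

  weakeningIndices : ∀ {C D} → C ⊆ D → indices C ⊆ indices D
  weakeningIndices C⊆D u∈ with l , l∈C , refl ← indices⁻ u∈ = indices⁺ (C⊆D l∈C)

  agreeFalsifies : ∀ {α β C} → AgreeOn (indices C) α β → Falsifies β C → Falsifies α C
  agreeFalsifies {C = C} agree falsified {lit y b} l∈C sat =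
    falsified l∈C (trans (sym (agree y (indices⁺ {C} l∈C))) sat)

  -- If such a strategy exists, no refutation of G has all its clauses of
  -- index-width below w: following the strategy backwards from the empty
  -- clause yields good assignments falsifying ever earlier clauses.
  narrow-refutation-impossible : ∀ {w} → Strategy w → (π : Refutation G) →
    ¬ (∀ u → length (indices (Refutation.cl π u)) < w)
  narrow-refutation-impossible σ π narrow = unreachable (fromℕ len) emptyPosition
    where
    open Strategy σ
    open Refutation π

    Position : Fin (suc len) → Set
    Position u = ∃ λ α → Good (indices (cl u)) α × Falsifies α (cl u)

    noLiteral : ∀ {l} → ¬ l ∈ cl (fromℕ len)
    noLiteral l∈ = ¬Any[] (subst (_ ∈_) empty l∈)

    emptyPosition : Position (fromℕ len)
    emptyPosition with α , good ← start =
      α , restrict (λ u∈ → ⊥-elim (noLiteral (proj₁ (proj₂ (indices⁻ u∈))))) good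
        , λ l∈ → ⊥-elim (noLiteral l∈)

    retreat : ∀ u → Position u → ∃ λ v → v <ᶠ u × Position v
    retreat u (α , good , falsified) with step u
    ... | inj₁ (C , axiom , C⊆) =
      ⊥-elim (sound axiom (restrict (weakeningIndices C⊆) good) λ l∈C → falsified (C⊆ l∈C))
    ... | inj₂ (v , v′ , v<u , v′<u , x , _ , _ , fromLeft , fromRight)
        with α′ , good′ , agree ← extend (narrow u) good (ι x)
           | α′ x in α′x
    ...   | false = v , v<u , α′ , restrict (premiseIndices fromLeft) good′
                  , premiseFalsified fromLeft (agreeFalsifies agree falsified)
                      λ sat → case trans (sym α′x) sat of λ ()
    ...   | true = v′ , v′<u , α′ , restrict (premiseIndices fromRight) good′
                  , premiseFalsified fromRight (agreeFalsifies agree falsified)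
                      λ sat → case trans (sym α′x) sat of λ ()

    unreachable : ∀ u → ¬ Position u
    unreachable = All.wfRec <-wellFounded _ (λ u → ¬ Position u) λ u ih p →
      let v , v<u , q = retreat u p in ih v<u q

module DecisionTreeStrategy (n m s w : ℕ) (F : Fin m → Clause (Fin n)) (unsat : Unsat F)
                            (room : n * (3 * w) < s) where

  open FreshNumbers using (fresh)
  open IndexWidthGame index (REF n m s F)

  -- The subtree below a node at depth d has height n ∸ d; a node of that
  -- height is placed at an index at least (n ∸ d) * K, K = 3w, so that each
  -- level of the tree has a window of K indices for fresh premises.
  K : ℕ
  K = 3 * w

  Room : ℕ → Fin s → Set
  Room d u = (n ∸ d) * K ≤ toℕ u

  -- What the Delayer lets clause u be: a node of the canonical decision tree
  -- of F querying X_0, X_1, … in this order.  A node at depth d with path β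
  -- stands for the clause {X_i^(¬β_i) | i < d} falsified by β; it is either a
  -- leaf weakening an axiom C_j falsified by β, or the resolvent on X_d of
  -- the clauses of its two children.
  data Role : Set where
    leaf  : Fin m → Role
    split : Fin n → Fin s → Fin s → Role

  record Node : Set where
    constructor node
    field
      depth : ℕ
      path  : Fin n → Bool
      role  : Role
  open Node

  InClause : Node → Fin n → Bool → Set
  InClause Q i b = toℕ i < depth Q × path Q i ≡ not b

  -- the unique values of i, j, v with V[u,i], I[u,j], L[u,v] and R[u,v] true
  pivotSel : Role → Fin (suc n)
  pivotSel (leaf _) = fz
  pivotSel (split x _ _) = fs x

  axiomSel : Role → Fin (suc m)
  axiomSel (leaf j) = fs j
  axiomSel (split _ _ _) = fz

  premiseSel : Bool → Role → Fin (suc s)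
  premiseSel _ (leaf _) = fz
  premiseSel true (split _ a _) = fs a
  premiseSel false (split _ _ a′) = fs a′

  -- the left premise (b = true) is the child with X_x set to true, so it
  -- contains X̄_x as A15 demands; the right premise (b = false) contains X_x
  data PremiseOf : Role → Bool → Fin s → Set where
    left  : ∀ {x a a′} → PremiseOf (split x a a′) true a
    right : ∀ {x a a′} → PremiseOf (split x a a′) false a′

  premiseVar : Bool → Fin s → Fin (suc s) → RVar n m s
  premiseVar true = L
  premiseVar false = R

  Holds : Node → RVar n m s → Set
  Holds Q (D _ i b) = InClause Q i b
  Holds Q (V _ i) = i ≡ pivotSel (role Q)
  Holds Q (I _ j) = j ≡ axiomSel (role Q)
  Holds Q (L _ v) = v ≡ premiseSel true (role Q)
  Holds Q (R _ v) = v ≡ premiseSel false (role Q)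

  holds? : ∀ Q y → Dec (Holds Q y)
  holds? Q (D _ i b) = (toℕ i <? depth Q) ×-dec (path Q i ≟ᵇ not b)
  holds? Q (V _ i) = i ≟ pivotSel (role Q)
  holds? Q (I _ j) = j ≟ axiomSel (role Q)
  holds? Q (L _ v) = v ≟ premiseSel true (role Q)
  holds? Q (R _ v) = v ≟ premiseSel false (role Q)

  encode : (Fin s → Node) → RVar n m s → Bool
  encode f y = does (holds? (f (index y)) y)

  PremiseOK : Fin s → ℕ → Fin s → Set
  PremiseOK u d v = v <ᶠ u × Room (suc d) v

  RoleOK : Fin s → Node → Role → Set
  RoleOK u Q (leaf j) = ∀ {i b} → lit i b ∈ F j → InClause Q i b
  RoleOK u Q (split x a a′) = toℕ x ≡ depth Q × PremiseOK u (depth Q) a × PremiseOK u (depth Q) a′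

  record WellPlaced (u : Fin s) (Q : Node) : Set where
    field
      rootAtEnd : suc (toℕ u) ≡ s → depth Q ≡ 0
      roleOK    : RoleOK u Q (role Q)
  open WellPlaced

  record IsChild (Q : Node) (b : Bool) (Q′ : Node) : Set where
    field
      deeper : depth Q′ ≡ suc (depth Q)
      turn   : ∀ i → toℕ i ≡ depth Q → path Q′ i ≡ b
      keep   : ∀ i → toℕ i < depth Q → path Q′ i ≡ path Q i
  open IsChild

  record Consistent (S : List (Fin s)) (f : Fin s → Node) : Set where
    field
      placed : ∀ {u} → u ∈ S → WellPlaced u (f u)
      linked : ∀ {u v b} → u ∈ S → v ∈ S → PremiseOf (role (f u)) b v → IsChild (f u) b (f v)
      uniqueParent : ∀ {u u′ v b b′} → u ∈ S → u′ ∈ S →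
                     PremiseOf (role (f u)) b v → PremiseOf (role (f u′)) b′ v → u ≡ u′ × b ≡ b′
  open Consistent

  Consistent-⊆ : ∀ {S S′ f} → S′ ⊆ S → Consistent S f → Consistent S′ f
  Consistent-⊆ sub c = record
    { placed = λ p → placed c (sub p)
    ; linked = λ p q → linked c (sub p) (sub q)
    ; uniqueParent = λ p q → uniqueParent c (sub p) (sub q) }

  premiseFromSel : ∀ r b v → fs v ≡ premiseSel b r → PremiseOf r b v
  premiseFromSel (split _ _ _) true _ refl = left
  premiseFromSel (split _ _ _) false _ refl = right

  premiseOK : ∀ {u Q r b v} → RoleOK u Q r → PremiseOf r b v → PremiseOK u (depth Q) v
  premiseOK (_ , ok , _) left = ok
  premiseOK (_ , _ , ok) right = ok

  pivotDepth : ∀ {u Q r b v i} → RoleOK u Q r → PremiseOf r b v → fs i ≡ pivotSel r → toℕ i ≡ depth Q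
  pivotDepth (x≡d , _) left refl = x≡d
  pivotDepth (x≡d , _) right refl = x≡d

  childHasPivot : ∀ {Q b Q′ i} → IsChild Q b Q′ → toℕ i ≡ depth Q → InClause Q′ i (not b)
  childHasPivot {Q} {b} {i = i} c i≡d =
    subst (toℕ i <_) (sym (deeper c)) (s≤s (≤-reflexive i≡d)) ,
    trans (turn c i i≡d) (sym (not-involutive b))

  childInherits : ∀ {Q b Q′ i i′ c} → IsChild Q b Q′ → toℕ i ≡ depth Q → i ≢ i′ →
                  InClause Q′ i′ c → InClause Q i′ c
  childInherits {Q} {i = i} {i′} ch i≡d i≢i′ (i′<d′ , p) = i′<d , trans (sym (keep ch i′ i′<d)) p
    where
    i′<d : toℕ i′ < depth Q
    i′<d = ≤∧≢⇒< (≤-pred (subst (toℕ i′ <_) (deeper ch) i′<d′))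
                 (λ e → i≢i′ (toℕ-injective (trans i≡d (sym e))))

  axiomOrPivot : ∀ r → fz ≡ axiomSel r ⊎ fz ≡ pivotSel r
  axiomOrPivot (leaf _) = inj₂ refl
  axiomOrPivot (split _ _ _) = inj₁ refl

  notAxiomAndPivot : ∀ r → fz ≡ axiomSel r → ¬ fz ≡ pivotSel r
  notAxiomAndPivot (split _ _ _) _ ()

  notAxiomAndPremise : ∀ r b → fz ≡ axiomSel r → ¬ fz ≡ premiseSel b r
  notAxiomAndPremise (split _ _ _) true _ ()
  notAxiomAndPremise (split _ _ _) false _ ()

  leafContains : ∀ {u Q r j i b} → RoleOK u Q r → fs j ≡ axiomSel r → lit i b ∈ F j → InClause Q i b
  leafContains {r = leaf _} contains refl = contains

  module AtFalsifiedClause {C f} (cons : Consistent (indices C) f) (falsified : Falsifies (encode f) C) where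

    holdsAt : ∀ {y} → neg y ∈ C → Holds (f (index y)) y
    holdsAt {y} y∈ with holds? (f (index y)) y | falsified y∈
    ... | yes h | _ = h
    ... | no _ | unsatisfied = ⊥-elim (unsatisfied refl)

    failsAt : ∀ {y} → pos y ∈ C → ¬ Holds (f (index y)) y
    failsAt {y} y∈ with holds? (f (index y)) y | falsified y∈
    ... | yes _ | unsatisfied = λ _ → unsatisfied refl
    ... | no ¬h | _ = ¬h

    roleAt : ∀ {u} → u ∈ indices C → RoleOK u (f u) (role (f u))
    roleAt u∈ = roleOK (placed cons u∈)

    splitAt : ∀ b {u v} → neg (premiseVar b u (fs v)) ∈ C → u ∈ indices C × PremiseOf (role (f u)) b v
    splitAt true p = indices⁺ p , premiseFromSel _ true _ (holdsAt p)
    splitAt false p = indices⁺ p , premiseFromSel _ false _ (holdsAt p)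

    childAt : ∀ b {u v l} → neg (premiseVar b u (fs v)) ∈ C → l ∈ C → index (var l) ≡ v →
              IsChild (f u) b (f v)
    childAt b p l∈ refl with u∈ , premise ← splitAt b p = linked cons u∈ (indices⁺ l∈) premise

    pivotAt : ∀ b {u v i} → neg (premiseVar b u (fs v)) ∈ C → neg (V u (fs i)) ∈ C → toℕ i ≡ depth (f u)
    pivotAt b p q with u∈ , premise ← splitAt b p = pivotDepth (roleAt u∈) premise (holdsAt q)

    earlier : ∀ b {u v} → neg (premiseVar b u (fs v)) ∈ C → toℕ u ≤ toℕ v → ⊥
    earlier b p with u∈ , premise ← splitAt b p = <⇒≱ (proj₁ (premiseOK (roleAt u∈) premise))

    pivotInPremise : ∀ b {u v i} → neg (premiseVar b u (fs v)) ∈ C → neg (V u (fs i)) ∈ C →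
                     pos (D v i (not b)) ∈ C → ⊥
    pivotInPremise b p q r = failsAt r (childHasPivot (childAt b p r refl) (pivotAt b p q))

    sideInResolvent : ∀ b {u v i i′ c} → i ≢ i′ → neg (premiseVar b u (fs v)) ∈ C →
                      neg (V u (fs i)) ∈ C → neg (D v i′ c) ∈ C → pos (D u i′ c) ∈ C → ⊥
    sideInResolvent b i≢i′ p q r t =
      failsAt t (childInherits (childAt b p r refl) (pivotAt b p q) i≢i′ (holdsAt r))

  axiomsHold : ∀ {C f} → REF n m s F C → Consistent (indices C) f → ¬ Falsifies (encode f) C
  axiomsHold {C} {f} axiom cons falsified = refute axiom
    where
    open AtFalsifiedClause cons falsified

    refute : REF n m s F C → ⊥
    refute (A1 u) = failsAt (∈-map⁺ (λ i → pos (V u i)) (∈-allFin (pivotSel (role (f u))))) refl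
    refute (A2 u) = failsAt (∈-map⁺ (λ j → pos (I u j)) (∈-allFin (axiomSel (role (f u))))) refl
    refute (A3 u) = failsAt (∈-map⁺ (λ v → pos (L u v)) (∈-allFin (premiseSel true (role (f u))))) refl
    refute (A4 u) = failsAt (∈-map⁺ (λ v → pos (R u v)) (∈-allFin (premiseSel false (role (f u))))) refl
    refute (A5 u _ _ i≢i′) = i≢i′ (trans (holdsAt (here refl)) (sym (holdsAt (there (here refl)))))
    refute (A6 u _ _ j≢j′) = j≢j′ (trans (holdsAt (here refl)) (sym (holdsAt (there (here refl)))))
    refute (A7 u _ _ v≢v′) = v≢v′ (trans (holdsAt (here refl)) (sym (holdsAt (there (here refl)))))
    refute (A8 u _ _ v≢v′) = v≢v′ (trans (holdsAt (here refl)) (sym (holdsAt (there (here refl)))))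
    refute (A9 u) = notAxiomAndPivot (role (f u)) (holdsAt (here refl)) (holdsAt (there (here refl)))
    refute (A10 u) with axiomOrPivot (role (f u))
    ... | inj₁ e = failsAt (here refl) e
    ... | inj₂ e = failsAt (there (here refl)) e
    refute (A11 u) = notAxiomAndPremise (role (f u)) true (holdsAt (here refl)) (holdsAt (there (here refl)))
    refute (A12 u) = notAxiomAndPremise (role (f u)) false (holdsAt (here refl)) (holdsAt (there (here refl)))
    refute (A13 u v u≤v) = earlier true (here refl) u≤v
    refute (A14 u v u≤v) = earlier false (here refl) u≤v
    refute (A15 u v i) = pivotInPremise true (here refl) (there (here refl)) (there (there (here refl)))
    refute (A16 u v i) = pivotInPremise false (here refl) (there (here refl)) (there (there (here refl)))
    refute (A17 u v i i′ i≢i′ c) = sideInResolvent true i≢i′ (here refl) (there (here refl))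
                                     (there (there (here refl))) (there (there (there (here refl))))
    refute (A18 u v i i′ i≢i′ c) = sideInResolvent false i≢i′ (here refl) (there (here refl))
                                     (there (there (here refl))) (there (there (there (here refl))))
    refute (A19 u j i b i∈Cj) =
      failsAt (there (here refl)) (leafContains (roleAt (indices⁺ (here refl))) (holdsAt (here refl)) i∈Cj)
    refute (A20 u i) with holdsAt {D u i false} (here refl) | holdsAt {D u i true} (there (here refl))
    ... | _ , isTrue | _ , isFalse = case trans (sym isTrue) isFalse of λ ()
    refute (A21 u last i b) =
      n≮0 (subst (toℕ i <_) (rootAtEnd (placed cons (indices⁺ (here refl))) last) (proj₁ (holdsAt (here refl))))

  -- A new node must not take as premise an index that is pebbled or already
  -- a premise; these are at most 3|S| < K indices.
  premisesOf : Role → List (Fin s)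
  premisesOf (leaf _) = []
  premisesOf (split _ a a′) = a ∷ a′ ∷ []

  occupied : (Fin s → Node) → List (Fin s) → List (Fin s)
  occupied f [] = []
  occupied f (u ∷ S) = u ∷ premisesOf (role (f u)) ++ occupied f S

  occupied-length : ∀ f S → length (occupied f S) ≤ 3 * length S
  occupied-length f [] = z≤n
  occupied-length f (u ∷ S) = begin
    suc (length (premisesOf (role (f u)) ++ occupied f S))
      ≡⟨ cong suc (length-++ (premisesOf (role (f u)))) ⟩
    suc (length (premisesOf (role (f u))) + length (occupied f S))
      ≤⟨ s≤s (+-mono-≤ (atMostTwo (role (f u))) (occupied-length f S)) ⟩
    3 + 3 * length S
      ≡⟨ *-suc 3 (length S) ⟨
    3 * length (u ∷ S) ∎
    where
    open ≤-Reasoning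
    atMostTwo : ∀ r → length (premisesOf r) ≤ 2
    atMostTwo (leaf _) = z≤n
    atMostTwo (split _ _ _) = ≤-refl

  occupied-pebbled : ∀ f {S u} → u ∈ S → u ∈ occupied f S
  occupied-pebbled f (here refl) = here refl
  occupied-pebbled f {u′ ∷ _} (there u∈) = there (∈-++⁺ʳ (premisesOf (role (f u′))) (occupied-pebbled f u∈))

  occupied-premise : ∀ f {S u b v} → u ∈ S → PremiseOf (role (f u)) b v → v ∈ occupied f S
  occupied-premise f (here refl) p = there (∈-++⁺ˡ (listed p))
    where
    listed : ∀ {r b v} → PremiseOf r b v → v ∈ premisesOf r
    listed left = here refl
    listed right = there (here refl)
  occupied-premise f {u′ ∷ _} (there u∈) p = there (∈-++⁺ʳ (premisesOf (role (f u′))) (occupied-premise f u∈ p))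

  record FreshRole (O : List (Fin s)) (r : Role) : Set where
    field
      avoids   : ∀ {b v} → PremiseOf r b v → v ∉ O
      distinct : ∀ {b b′ v} → PremiseOf r b v → PremiseOf r b′ v → b ≡ b′
  open FreshRole

  freshIndex : ∀ (O : List (Fin s)) lo {k t} → length O < k → lo + k ≤ toℕ t →
               ∃ λ a → a ∉ O × lo ≤ toℕ a × a <ᶠ t
  freshIndex O lo {k} {t} short window
    with v , lo≤v , v<hi , v∉O ← fresh k (map toℕ O) lo (subst (_< k) (sym (length-map toℕ O)) short) =
    a , (λ a∈O → v∉O (subst (_∈ map toℕ O) a≡v (∈-map⁺ toℕ a∈O)))
      , subst (lo ≤_) (sym a≡v) lo≤v , subst (_< toℕ t) (sym a≡v) v<t
    where
    v<t : v < toℕ t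
    v<t = <-≤-trans v<hi window
    a = fromℕ< (<-trans v<t (toℕ<n t))
    a≡v : toℕ a ≡ v
    a≡v = toℕ-fromℕ< (<-trans v<t (toℕ<n t))

  satisfies? : ∀ {β : Fin n → Bool} l → Dec (SatLit β l)
  satisfies? {β} (lit i b) = β i ≟ᵇ b

  falsifiedAxiom : (β : Fin n → Bool) → ∃ λ j → ∀ {i b} → lit i b ∈ F j → β i ≡ not b
  falsifiedAxiom β with j , unsatisfied ← ¬∀⟶∃¬ m (λ j → SatClause β (F j)) (λ j → any? satisfies? (F j))
                                                   (λ all → unsat (β , all)) =
    j , λ i∈ → ¬-not (λ βi≡b → unsatisfied (lose i∈ βi≡b))

  premiseWindow : ∀ {d t} → d < n → Room d t → (n ∸ suc d) * K + K ≤ toℕ t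
  premiseWindow {d} {t} d<n roomy = begin
    (n ∸ suc d) * K + K  ≡⟨ +-comm ((n ∸ suc d) * K) K ⟩
    suc (n ∸ suc d) * K  ≡⟨ cong (_* K) (+-∸-assoc 1 d<n) ⟨
    (n ∸ d) * K          ≤⟨ roomy ⟩
    toℕ t                ∎
    where open ≤-Reasoning

  freshRole : ∀ (O : List (Fin s)) t d β → suc (length O) < K → d ≤ n → (d < n → Room d t) →
              ∃ λ r → RoleOK t (node d β r) r × FreshRole O r
  freshRole O t d β short d≤n roomy with d <? n
  ... | yes d<n
    with a , a∉O , lo≤a , a<t ← freshIndex O ((n ∸ suc d) * K) (<-trans (n<1+n _) short)
                                           (premiseWindow d<n (roomy d<n))
    with a′ , a′∉ , lo≤a′ , a′<t ← freshIndex (a ∷ O) ((n ∸ suc d) * K) short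
                                              (premiseWindow d<n (roomy d<n)) =
    split (fromℕ< d<n) a a′ , (toℕ-fromℕ< d<n , (a<t , lo≤a) , (a′<t , lo≤a′)) ,
    record { avoids = λ { left → a∉O ; right → λ a′∈O → a′∉ (there a′∈O) }
           ; distinct = λ { left left → refl ; right right → refl
                          ; left right → ⊥-elim (a′∉ (here refl)) ; right left → ⊥-elim (a′∉ (here refl)) } }
  ... | no d≮n with j , falsified ← falsifiedAxiom β =
    leaf j , (λ i∈ → <-≤-trans (toℕ<n _) (≮⇒≥ d≮n) , falsified i∈) ,
    record { avoids = λ () ; distinct = λ () }

  adjoin : ∀ {S f g t Q} → Consistent S f → g t ≡ Q → (∀ {u} → u ∈ S → g u ≡ f u) →
           WellPlaced t Q → FreshRole (occupied f S) (role Q) →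
           (∀ {u b} → u ∈ S → PremiseOf (role (f u)) b t → IsChild (f u) b Q) →
           Consistent (t ∷ S) g
  adjoin {S} {f} {g} {t} {Q} cons gt≡Q old placedQ freshQ parentsQ =
    record { placed = placed′ ; linked = linked′ ; uniqueParent = unique′ }
    where
    placed′ : ∀ {u} → u ∈ t ∷ S → WellPlaced u (g u)
    placed′ (here refl) rewrite gt≡Q = placedQ
    placed′ (there u∈) rewrite old u∈ = placed cons u∈

    linked′ : ∀ {u v b} → u ∈ t ∷ S → v ∈ t ∷ S → PremiseOf (role (g u)) b v → IsChild (g u) b (g v)
    linked′ (here refl) (here refl) p rewrite gt≡Q =
      ⊥-elim (<-irrefl refl (proj₁ (premiseOK (roleOK placedQ) p)))
    linked′ (here refl) (there v∈) p rewrite gt≡Q = ⊥-elim (avoids freshQ p (occupied-pebbled f v∈))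
    linked′ (there u∈) (here refl) p rewrite gt≡Q | old u∈ = parentsQ u∈ p
    linked′ (there u∈) (there v∈) p rewrite old u∈ | old v∈ = linked cons u∈ v∈ p

    unique′ : ∀ {u u′ v b b′} → u ∈ t ∷ S → u′ ∈ t ∷ S →
              PremiseOf (role (g u)) b v → PremiseOf (role (g u′)) b′ v → u ≡ u′ × b ≡ b′
    unique′ (here refl) (here refl) p p′ rewrite gt≡Q = refl , distinct freshQ p p′
    unique′ (here refl) (there u′∈) p p′ rewrite gt≡Q | old u′∈ =
      ⊥-elim (avoids freshQ p (occupied-premise f u′∈ p′))
    unique′ (there u∈) (here refl) p p′ rewrite gt≡Q | old u∈ =
      ⊥-elim (avoids freshQ p′ (occupied-premise f u∈ p))
    unique′ (there u∈) (there u′∈) p p′ rewrite old u∈ | old u′∈ = uniqueParent cons u∈ u′∈ p p′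

  turnAt : (Fin n → Bool) → ℕ → Bool → Fin n → Bool
  turnAt β d b i with toℕ i ≟ℕ d
  ... | yes _ = b
  ... | no _ = β i

  childNode : ∀ Q b r → IsChild Q b (node (suc (depth Q)) (turnAt (path Q) (depth Q) b) r)
  childNode Q b r = record { deeper = refl ; turn = turned ; keep = kept }
    where
    turned : ∀ i → toℕ i ≡ depth Q → turnAt (path Q) (depth Q) b i ≡ b
    turned i i≡d with toℕ i ≟ℕ depth Q
    ... | yes _ = refl
    ... | no i≢d = ⊥-elim (i≢d i≡d)
    kept : ∀ i → toℕ i < depth Q → turnAt (path Q) (depth Q) b i ≡ path Q i
    kept i i<d with toℕ i ≟ℕ depth Q
    ... | yes i≡d = ⊥-elim (<-irrefl i≡d i<d)
    ... | no _ = refl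

  premise? : ∀ r t → Dec (∃ λ b → PremiseOf r b t)
  premise? (leaf _) t = no λ ()
  premise? (split x a a′) t with a ≟ t | a′ ≟ t
  ... | yes refl | _ = yes (true , left)
  ... | no _ | yes refl = yes (false , right)
  ... | no a≢t | no a′≢t = no λ { (true , left) → a≢t refl ; (false , right) → a′≢t refl }

  splitDepth : ∀ {u Q r b v} → RoleOK u Q r → PremiseOf r b v → depth Q < n
  splitDepth {r = split x _ _} (x≡d , _) _ = subst (_< n) x≡d (toℕ<n x)

  -- If t
  -- is a premise of a split in S it receives the corresponding child (unique
  -- by consistency); otherwise it becomes the root if it is the last index,
  -- and a leaf otherwise.
  module Extension {S f} (short : length S < w) (cons : Consistent S f) (t : Fin s) where

    fewOccupied : suc (length (occupied f S)) < K
    fewOccupied = begin-strict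
      suc (length (occupied f S))  ≤⟨ s≤s (occupied-length f S) ⟩
      suc (3 * length S)           <⟨ s≤s (s≤s (n≤1+n _)) ⟩
      3 + 3 * length S             ≡⟨ *-suc 3 (length S) ⟨
      3 * suc (length S)           ≤⟨ *-monoʳ-≤ 3 short ⟩
      K                            ∎
      where open ≤-Reasoning

    record NewNode : Set where
      field
        Q       : Node
        placedQ : WellPlaced t Q
        freshQ  : FreshRole (occupied f S) (role Q)
        parentsQ : ∀ {u b} → u ∈ S → PremiseOf (role (f u)) b t → IsChild (f u) b Q

    newNode : ∀ d β → d ≤ n → (d < n → Room d t) → (suc (toℕ t) ≡ s → d ≡ 0) →
              (∀ {u b} r → u ∈ S → PremiseOf (role (f u)) b t → IsChild (f u) b (node d β r)) → NewNode
    newNode d β d≤n roomy rootAtEnd parents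
      with r , roleOK , freshR ← freshRole (occupied f S) t d β fewOccupied d≤n roomy =
      record { Q = node d β r ; placedQ = record { rootAtEnd = rootAtEnd ; roleOK = roleOK }
             ; freshQ = freshR ; parentsQ = parents r }

    chooseNode : NewNode
    chooseNode with any? (λ u → premise? (role (f u)) t) S
    ... | yes hasParent with p , p∈S , b , premise ← find hasParent =
      newNode (suc (depth (f p))) (turnAt (path (f p)) (depth (f p)) b)
              (splitDepth roleP premise) (λ _ → proj₂ (premiseOK roleP premise))
              (λ last → ⊥-elim (<-irrefl last (≤-<-trans (proj₁ (premiseOK roleP premise)) (toℕ<n p))))
              (λ r u∈ premise′ → child r (uniqueParent cons u∈ p∈S premise′ premise))
      where
      roleP = roleOK (placed cons p∈S)
      child : ∀ {u b′} r → u ≡ p × b′ ≡ b →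
              IsChild (f u) b′ (node (suc (depth (f p))) (turnAt (path (f p)) (depth (f p)) b) r)
      child r (refl , refl) = childNode (f p) b r
    ... | no orphan with suc (toℕ t) ≟ℕ s
    ...   | yes last = newNode 0 (const false) z≤n (λ _ → ≤-pred (subst (n * K <_) (sym last) room))
                               (λ _ → refl) (λ _ u∈ premise → ⊥-elim (orphan (lose u∈ (_ , premise))))
    ...   | no notLast = newNode n (const false) ≤-refl (λ n<n → ⊥-elim (<-irrefl refl n<n))
                                 (λ last → ⊥-elim (notLast last))
                                 (λ _ u∈ premise → ⊥-elim (orphan (lose u∈ (_ , premise))))

  extendPlacement : ∀ {S f} → length S < w → Consistent S f → (t : Fin s) →
                    ∃ λ f′ → Consistent (t ∷ S) f′ × (∀ {u} → u ∈ S → f′ u ≡ f u)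
  extendPlacement {S} {f} short cons t with any? (t ≟_) S
  ... | yes t∈S = f , Consistent-⊆ (λ { (here refl) → t∈S ; (there u∈) → u∈ }) cons , λ _ → refl
  ... | no t∉S = updateAt f t (const Q) ,
                 adjoin cons (updateAt-updates t f) same placedQ freshQ parentsQ , same
    where
    open Extension short cons t
    open NewNode chooseNode
    same : ∀ {u} → u ∈ S → updateAt f t (const Q) u ≡ f u
    same {u} u∈ = updateAt-minimal u t f (λ { refl → t∉S u∈ })

  strategy : Strategy w
  strategy = record
    { Good = Good
    ; start = encode f₀ , f₀ , emptyConsistent , λ _ ()
    ; restrict = λ { sub (f , cons , agree) → f , Consistent-⊆ sub cons , λ y y∈ → agree y (sub y∈) }
    ; sound = λ { axiom (f , cons , agree) falsified → axiomsHold axiom cons (agreeFalsifies agree falsified) }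
    ; extend = extend }
    where
    Good : List (Fin s) → (RVar n m s → Bool) → Set
    Good S α = ∃ λ f → Consistent S f × AgreeOn S (encode f) α

    f₀ : Fin s → Node
    f₀ _ = node 0 (const false) (leaf (proj₁ (falsifiedAxiom (const false))))

    emptyConsistent : Consistent [] f₀
    emptyConsistent = record { placed = λ () ; linked = λ () ; uniqueParent = λ () }

    extend : ∀ {S α} → length S < w → Good S α → (t : Fin s) →
             ∃ λ α′ → Good (t ∷ S) α′ × AgreeOn S α′ α
    extend short (f , cons , agree) t with f′ , cons′ , same ← extendPlacement short cons t =
      encode f′ , (f′ , cons′ , λ _ _ → refl) ,
      λ y y∈ → trans (cong (λ Q → does (holds? Q y)) (same y∈)) (agree y y∈)

narrowClauses : ∀ {n m s w} {G : CNF (RVar n m s)} (π : Refutation G) → refIndexWidth π < w →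
                ∀ u → indexWidth (Refutation.cl π u) < w
narrowClauses {w = w} π narrow u = AllList.lookup (map⁻ (foldr-forcesᵇ below 0 _ narrow)) (∈-allFin u)
  where
  below : ∀ x y → x ⊔ y < w → x < w × y < w
  below x y x⊔y<w = m⊔n<o⇒m<o x y x⊔y<w , m⊔n<o⇒n<o x y x⊔y<w

levelsFit : ∀ n w s → 1 ≤ n → 1 ≤ w → 6 * n * w ≤ s → n * (3 * w) < s
levelsFit n w s n≥1 w≥1 6nw≤s =
  <-≤-trans (m<m+n (n * (3 * w)) (*-mono-≤ n≥1 (≤-trans w≥1 (m≤m+n w _))))
            (≤-trans (≤-reflexive (doubled n w)) 6nw≤s)
  where
  doubled : ∀ n w → n * (3 * w) + n * (3 * w) ≡ 6 * n * w
  doubled = solve-∀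

lemma4p1 : (n w s m : ℕ) → 1 ≤ n → 1 ≤ w → 1 ≤ s → s ≤ 2 ^ n → 6 * n * w ≤ s →
           (F : Fin m → Clause (Fin n)) → (∀ j → NonTaut (F j)) → Unsat F →
           (π : Refutation (REF n m s F)) → w ≤ refIndexWidth π
lemma4p1 n w s m n≥1 w≥1 _ _ 6nw≤s F _ unsat π with w ≤? refIndexWidth π
... | yes wide = wide
... | no ¬wide = ⊥-elim (narrow-refutation-impossible strategy π (narrowClauses π (≰⇒> ¬wide)))
  where
  open DecisionTreeStrategy n m s w F unsat (levelsFit n w s n≥1 w≥1 6nw≤s)
  open IndexWidthGame index (REF n m s F)
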